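{- Let $\mathsf{L}$ be a description logic, $C \in \mathsf{L}$ a concept, and $\mathcal{T}$ a TBox. For every admissible interpretation $\mathcal{I} \in \mathsf{Int}(\mathsf{L})$ with $C^{\mathcal{I}} \neq \emptyset$: (1) every interpretation $\mathcal{I}'$ that stems from the canonical witness $\mathcal{W}_{\mathcal{I}}$ is isomorphic to $\mathcal{I}$; (2) $\mathcal{W}_{\mathcal{I}}$ is a witness for $C$; (3) $\mathcal{W}_{\mathcal{I}}$ is admissible with respect to $\mathcal{T}$ if and only if $\mathcal{I} \models \mathcal{T}$.
   Context: A description logic (DL) $\mathsf{L}$ is based on infinite sets $\mathsf{NC}$ of atomic concepts and $\mathsf{NR}$ of atomic roles; $\mathsf{L}$ is identified with its set of well-formed concepts, which is closed under boolean operations ($\sqcap,\sqcup,\neg$) and sub-concepts. An interpretation is a pair $\mathcal{I}=(\Delta^{\mathcal{I}},\cdot^{\mathcal{I}})$ with $\Delta^{\mathcal{I}}$ a non-empty set and $\cdot^{\mathcal{I}}$ mapping $\mathsf{NC}$ to $2^{\Delta^{\mathcal{I}}}$ and $\mathsf{NR}$ to $2^{\Delta^{\mathcal{I}}\times\Delta^{\mathcal{I}}}$. With $\mathsf{L}$ is associated a set $\mathsf{Int}(\mathsf{L})$ of admissible interpretations, closed under isomorphism, such that for any two interpretations agreeing on $\mathsf{NR}$, one is in $\mathsf{Int}(\mathsf{L})$ iff the other is. Every $\mathcal{I}\in\mathsf{Int}(\mathsf{L})$ extends to all concepts $C\in\mathsf{L}$ so that (I1) boolean combinations of concepts are interpreted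 as the corresponding boolean combinations (union, intersection, complement in $\Delta^{\mathcal{I}}$) of their interpretations, and (I2) $C^{\mathcal{I}}$ depends only on the interpretations of the atomic concepts and roles occurring syntactically in $C$. A TBox $\mathcal{T}$ is a finite set of axioms $C_1\sqsubseteq C_2$ or $C_1\doteq C_2$ with $C_i\in\mathsf{L}$. $\mathcal{I}\in\mathsf{Int}(\mathsf{L})$ is a model of $\mathcal{T}$ ($\mathcal{I}\models\mathcal{T}$) iff $C_1^{\mathcal{I}}\subseteq C_2^{\mathcal{I}}$ for each $C_1\sqsubseteq C_2\in\mathcal{T}$ and $C_1^{\mathcal{I}}=C_2^{\mathcal{I}}$ for each $C_1\doteq C_2\in\mathcal{T}$. A witness for $C\in\mathsf{L}$ is a triple $\mathcal{W}=(\Delta^{\mathcal{W}},\cdot^{\mathcal{W}},\mathcal{L}^{\mathcal{W}})$ with $\Delta^{\mathcal{W}}$ non-empty, $\cdot^{\mathcal{W}}$ mapping $\mathsf{NR}$ to $2^{\Delta^{\mathcal{W}}\times\Delta^{\mathcal{W}}}$, and $\mathcal{L}^{\mathcal{W}}:\Delta^{\mathcal{W}}\to 2^{\mathsf{L}}$, such that (W1) some $x\in\Delta^{\mathcal{W}}$ has $C\in\mathcal{L}^{\mathcal{W}}(x)$; (W2) some $\mathcal{I}\in\mathsf{Int}(\mathsf{L})$ stems from $\mathcal{W}$; (W3) for every $\mathcal{I}\in\mathsf{Int}(\mathsf{L})$ stemming from $\mathcal{W}$, $D\in\mathcal{L}^{\mathcal{W}}(x)$ implies $x\in D^{\mathcal{I}}$.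 An interpretation $\mathcal{I}$ stems from $\mathcal{W}$ if $\Delta^{\mathcal{I}}=\Delta^{\mathcal{W}}$, $\cdot^{\mathcal{I}}$ restricted to $\mathsf{NR}$ equals $\cdot^{\mathcal{W}}$, and for every $A\in\mathsf{NC}$: $A\in\mathcal{L}^{\mathcal{W}}(x)\Rightarrow x\in A^{\mathcal{I}}$ and $\neg A\in\mathcal{L}^{\mathcal{W}}(x)\Rightarrow x\notin A^{\mathcal{I}}$. A witness is admissible w.r.t. $\mathcal{T}$ if some $\mathcal{I}\in\mathsf{Int}(\mathsf{L})$ stemming from it satisfies $\mathcal{I}\models\mathcal{T}$. For $\mathcal{I}\in\mathsf{Int}(\mathsf{L})$ the canonical witness $\mathcal{W}_{\mathcal{I}}$ has domain $\Delta^{\mathcal{I}}$, role map $\cdot^{\mathcal{I}}$ restricted to $\mathsf{NR}$, and labelling $x\mapsto\{D\in\mathsf{L}\mid x\in D^{\mathcal{I}}\}$. -}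

module Defs where

open import Data.Bool using (Bool; true; false; _∧_; _∨_; not)
open import Data.Nat using (ℕ)
open import Data.Product using (Σ; _×_; _,_)
open import Data.Sum using (_⊎_)
open import Data.Empty using (⊥)
open import Data.List using (List)
open import Data.List.Relation.Unary.All using (All)
open import Function.Bundles using (_↔_; _↣_; Inverse)
open import Relation.Binary.PropositionalEquality using (_≡_)

-- Subsets of a set X are represented as characteristic functions X → Bool
-- (i.e. 2^X literally as maps into 2).

-- An interpretation over domain Δ (Δ must be non-empty; this is recorded by
-- an irrelevant element of Δ).
record Interp (NC NR Δ : Set) : Set where
  field
    .nonEmpty : Δ
    conc : NC → Δ → Bool
    role : NR → Δ → Δ → Bool

open Interp public

record Iso {NC NR Δ Δ' : Set} (I : Interp NC NR Δ) (J : Interp NC NR Δ') : Set where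
  field
    bij : Δ ↔ Δ'
  open Inverse bij using (to)
  field
    conc-pres : ∀ A x → conc I A x ≡ conc J A (to x)
    role-pres : ∀ r x y → role I r x y ≡ role J r (to x) (to y)

record DL : Set₁ where
  infixr 7 _⊓_
  infixr 6 _⊔_
  field
    NC NR : Set
    NC-infinite : ℕ ↣ NC
    NR-infinite : ℕ ↣ NR
    Con : Set
    atom : NC → Con
    _⊓_ _⊔_ : Con → Con → Con
    neg : Con → Con
    occC : Con → NC → Set
    occR : Con → NR → Set
    occC-atom : ∀ A B → occC (atom A) B → A ≡ B
    occR-atom : ∀ A r → occR (atom A) r → ⊥
    occC-⊓ : ∀ C D A → occC (C ⊓ D) A → occC C A ⊎ occC D A
    occC-⊔ : ∀ C D A → occC (C ⊔ D) A → occC C A ⊎ occC D A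
    occC-neg : ∀ C A → occC (neg C) A → occC C A
    occR-⊓ : ∀ C D r → occR (C ⊓ D) r → occR C r ⊎ occR D r
    occR-⊔ : ∀ C D r → occR (C ⊔ D) r → occR C r ⊎ occR D r
    occR-neg : ∀ C r → occR (neg C) r → occR C r
    Int : {Δ : Set} → Interp NC NR Δ → Set
    Int-iso : ∀ {Δ Δ'} {I : Interp NC NR Δ} {J : Interp NC NR Δ'} →
              Iso I J → Int I → Int J
    Int-roles : ∀ {Δ} (I J : Interp NC NR Δ) →
                (∀ r x y → role I r x y ≡ role J r x y) → Int I → Int J
    ext : ∀ {Δ} (I : Interp NC NR Δ) → Int I → Con → Δ → Bool
    ext-atom : ∀ {Δ} (I : Interp NC NR Δ) (p : Int I) A x →
               ext I p (atom A) x ≡ conc I A x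
    ext-⊓ : ∀ {Δ} (I : Interp NC NR Δ) (p : Int I) C D x →
            ext I p (C ⊓ D) x ≡ (ext I p C x ∧ ext I p D x)
    ext-⊔ : ∀ {Δ} (I : Interp NC NR Δ) (p : Int I) C D x →
            ext I p (C ⊔ D) x ≡ (ext I p C x ∨ ext I p D x)
    ext-neg : ∀ {Δ} (I : Interp NC NR Δ) (p : Int I) C x →
              ext I p (neg C) x ≡ not (ext I p C x)
    -- (I2)
    ext-local : ∀ {Δ} (I J : Interp NC NR Δ) (p : Int I) (q : Int J) C →
                (∀ A → occC C A → ∀ x → conc I A x ≡ conc J A x) →
                (∀ r → occR C r → ∀ x y → role I r x y ≡ role J r x y) →
                ∀ x → ext I p C x ≡ ext J q C x

module _ (L : DL) where
  open DL L

  data Axiom : Set where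
    _⊑_ : Con → Con → Axiom
    _≐_ : Con → Con → Axiom

  TBox : Set
  TBox = List Axiom

  SatAx : ∀ {Δ} (I : Interp NC NR Δ) → Int I → Axiom → Set
  SatAx I p (C ⊑ D) = ∀ x → ext I p C x ≡ true → ext I p D x ≡ true
  SatAx I p (C ≐ D) = ∀ x → ext I p C x ≡ ext I p D x

  Models : ∀ {Δ} (I : Interp NC NR Δ) → Int I → TBox → Set
  Models I p T = All (SatAx I p) T

  record WitnessData (Δ : Set) : Set where
    field
      .nonEmptyW : Δ
      roleW : NR → Δ → Δ → Bool
      label : Δ → Con → Bool

  open WitnessData public

  StemsFrom : ∀ {Δ} → Interp NC NR Δ → WitnessData Δ → Set
  StemsFrom I W =
    (∀ r x y → role I r x y ≡ roleW W r x y) ×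
    (∀ A x → label W x (atom A) ≡ true → conc I A x ≡ true) ×
    (∀ A x → label W x (neg (atom A)) ≡ true → conc I A x ≡ false)

  IsWitnessFor : ∀ {Δ} → WitnessData Δ → Con → Set
  IsWitnessFor {Δ} W C =
    Σ Δ (λ x → label W x C ≡ true) ×
    -- (W2)
    Σ (Interp NC NR Δ) (λ I → Int I × StemsFrom I W) ×
    -- (W3)
    (∀ (I : Interp NC NR Δ) (p : Int I) → StemsFrom I W →
       ∀ x D → label W x D ≡ true → ext I p D x ≡ true)

  Admissible : ∀ {Δ} → WitnessData Δ → TBox → Set
  Admissible {Δ} W T =
    Σ (Interp NC NR Δ) (λ I → Σ (Int I) (λ p → StemsFrom I W × Models I p T))

  canonical : ∀ {Δ} (I : Interp NC NR Δ) → Int I → WitnessData Δ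
  canonical I@record { nonEmpty = e } p = record
    { nonEmptyW = e
    ; roleW = role I
    ; label = λ x D → ext I p D x
    }

{-# OPTIONS --safe #-}
-- The label of x in the canonical witness of I contains A or ¬A according to
-- whether x ∈ A^I, so every interpretation stemming from it agrees with I on all
-- atomic concepts and roles, hence by (I2) on all concepts. The identity is then
-- an isomorphism, (W3) and TBox satisfaction transfer back to I, and I itself
-- stems from its canonical witness, which gives (W2) and admissibility.
module Submission where

open import Defs
open import Data.Bool using (Bool; true; false; not)
open import Data.Bool.Properties using (not-injective)
open import Data.Product using (Σ; _×_; _,_)
open import Data.List.Relation.Unary.All as All using ()
open import Function.Bundles using (_⇔_; mk⇔)
open import Function.Construct.Identity using (↔-id)
open import Relation.Binary.PropositionalEquality using (_≡_; refl; sym; trans; cong)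

≡-from-implications : ∀ (b c : Bool) → (b ≡ true → c ≡ true) → (b ≡ false → c ≡ false) → c ≡ b
≡-from-implications true  c t f = t refl
≡-from-implications false c t f = f refl

module _ (L : DL) where
  open DL L

  AgreeOnAtoms : ∀ {Δ} → Interp NC NR Δ → Interp NC NR Δ → Set
  AgreeOnAtoms I J = (∀ A x → conc I A x ≡ conc J A x) × (∀ r x y → role I r x y ≡ role J r x y)

  agreeOnAtoms⇒Iso : ∀ {Δ} {I J : Interp NC NR Δ} → AgreeOnAtoms I J → Iso I J
  agreeOnAtoms⇒Iso {Δ} (conc≡ , role≡) =
    record { bij = ↔-id Δ ; conc-pres = conc≡ ; role-pres = role≡ }

  agreeOnAtoms⇒ext≡ : ∀ {Δ} {I J : Interp NC NR Δ} (p : Int I) (q : Int J) →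
                      AgreeOnAtoms I J → ∀ D x → ext I p D x ≡ ext J q D x
  agreeOnAtoms⇒ext≡ {I = I} {J} p q (conc≡ , role≡) D =
    ext-local I J p q D (λ A _ → conc≡ A) (λ r _ → role≡ r)

  module _ {Δ} {I J : Interp NC NR Δ} {p : Int I} {q : Int J}
           (ext≡ : ∀ D x → ext I p D x ≡ ext J q D x) where

    SatAx-transfer : ∀ ax → SatAx L I p ax → SatAx L J q ax
    SatAx-transfer (C ⊑ D) sat x C∋x =
      trans (sym (ext≡ D x)) (sat x (trans (ext≡ C x) C∋x))
    SatAx-transfer (C ≐ D) sat x =
      trans (sym (ext≡ C x)) (trans (sat x) (ext≡ D x))

    Models-transfer : ∀ T → Models L I p T → Models L J q T
    Models-transfer T = All.map (λ {ax} → SatAx-transfer ax)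

  ext-neg-atom : ∀ {Δ} (I : Interp NC NR Δ) (p : Int I) A x →
                 ext I p (neg (atom A)) x ≡ not (conc I A x)
  ext-neg-atom I p A x = trans (ext-neg I p (atom A) x) (cong not (ext-atom I p A x))

  module _ {Δ} (I : Interp NC NR Δ) (p : Int I) where

    stemsFrom-canonical : StemsFrom L I (canonical L I p)
    stemsFrom-canonical =
      (λ r x y → refl) ,
      (λ A x A∈ → trans (sym (ext-atom I p A x)) A∈) ,
      (λ A x ¬A∈ → not-injective (trans (sym (ext-neg-atom I p A x)) ¬A∈))

    stemsFrom-canonical⇒AgreeOnAtoms : ∀ I' → StemsFrom L I' (canonical L I p) →
                                       AgreeOnAtoms I' I
    stemsFrom-canonical⇒AgreeOnAtoms I' (role≡ , A∈⇒ , ¬A∈⇒) =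
      conc≡ , role≡
      where
      conc≡ : ∀ A x → conc I' A x ≡ conc I A x
      conc≡ A x = ≡-from-implications (conc I A x) (conc I' A x)
        (λ A∈ → A∈⇒ A x (trans (ext-atom I p A x) A∈))
        (λ A∉ → ¬A∈⇒ A x (trans (ext-neg-atom I p A x) (cong not A∉)))

mainTheorem1 : (L : DL) (C : DL.Con L) (T : TBox L) {Δ : Set}
    (I : Interp (DL.NC L) (DL.NR L) Δ) (p : DL.Int L I) →
    Σ Δ (λ x → DL.ext L I p C x ≡ true) →
    ((I' : Interp (DL.NC L) (DL.NR L) Δ) →
    StemsFrom L I' (canonical L I p) → Iso I' I)
    × IsWitnessFor L (canonical L I p) C
    × (Admissible L (canonical L I p) T ⇔ Models L I p T)
mainTheorem1 L C T I p C∋x =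
  (λ I' stems → agreeOnAtoms⇒Iso L (agree I' stems))
  , (C∋x , (I , p , stemsFrom-canonical L I p) ,
     λ I' p' stems x D D∈ → trans (agreeOnAtoms⇒ext≡ L p' p (agree I' stems) D x) D∈)
  , mk⇔ (λ { (I' , p' , stems , models) →
             Models-transfer L (agreeOnAtoms⇒ext≡ L p' p (agree I' stems)) T models })
        (λ models → I , p , stemsFrom-canonical L I p , models)
  where agree = stemsFrom-canonical⇒AgreeOnAtoms L I p
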